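{- Let $\mathcal{G}$ be a graph class with the SQGC property and let $\Pi$ be a contraction-bidimensional problem. Then there exist constants $\alpha>0$ and $0<\epsilon<1$ such that for every connected graph $G\in\mathcal{G}$, $\operatorname{tw}(G)\le\alpha\cdot(OPT_\Pi(G))^{\epsilon}$.
   Context: A vertex/edge subset problem $\Pi$ is given by a predicate $\phi(G,S)$, $S\subseteq V(G)$ or $S\subseteq E(G)$. $(G,k)\in\Pi$ iff some feasible $S$ has $|S|\le k$ (minimization) or $|S|\ge k$ (maximization). $OPT_\Pi(G)$ is the minimum (resp. maximum) such $k$. $\Pi$ is contraction-closed if $OPT_\Pi(G/uv)\le OPT_\Pi(G)$ for every edge $uv$. $\Pi$ is contraction-bidimensional if it is contraction-closed and there is $c>0$ with $OPT_\Pi(\Gamma_k)\ge ck^2$ for all $k$. Here $\Gamma_t$ is obtained from the $t\times t$ grid $\boxplus_t$ (vertices $(x,y)$, $1\le x,y\le t$, adjacent iff $|x-x'|+|y-y'|=1$) by adding, for $1\le x,y\le t-1$, the edge $(x+1,y)(x,y+1)$, and making $(t,t)$ adjacent to all vertices $(x,y)$ with $x\in\{1,t\}$ or $y\in\{1,t\}$. $\mathcal{G}$ has the SQGC property if there are constants $\lambda>0$ and $1\le c<2$ such that every connected $G\in\mathcal{G}$ that excludes $\Gamma_t$ as a contraction has treewidth at most $\lambda t^c$. -}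

module Defs where

open import Data.Nat using (ℕ; zero; suc; _+_; _*_; _∸_; _^_; _≤_; _<ᵇ_)
open import Data.Fin using (Fin; toℕ; remQuot)
open import Data.Fin.Subset using (Subset; _∈_; ∣_∣)
open import Data.Bool using (Bool; true; false; _∧_; if_then_else_)
open import Data.List using (List; map; allFin)
open import Data.Nat.ListAction using (sum)
open import Data.Product using (Σ; ∃; _×_; _,_; proj₁; proj₂)
open import Data.Sum using (_⊎_; inj₁; inj₂)
open import Data.Empty using (⊥)
open import Relation.Nullary using (¬_)
open import Relation.Binary.PropositionalEquality using (_≡_; _≢_; refl)
open import Relation.Binary.Construct.Closure.ReflexiveTransitive using (Star)

record Graph : Set₁ where
  field
    n      : ℕ
    E      : Fin n → Fin n → Set
    E-sym  : ∀ {u v} → E u v → E v u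
    E-irr  : ∀ {u} → ¬ E u u
open Graph public

mkGraph : (m : ℕ) → (Fin m → Fin m → Set) → Graph
mkGraph m R = record
  { n = m
  ; E = λ u v → u ≢ v × (R u v ⊎ R v u)
  ; E-sym = λ { (u≢v , inj₁ r) → (λ e → u≢v (sym' e)) , inj₂ r
              ; (u≢v , inj₂ r) → (λ e → u≢v (sym' e)) , inj₁ r }
  ; E-irr = λ { (u≢u , _) → u≢u refl }
  }
  where
  sym' : ∀ {A : Set} {x y : A} → x ≡ y → y ≡ x
  sym' refl = refl

Connected : Graph → Set
Connected G = (1 ≤ n G) × (∀ u v → Star (E G) u v)

InducesConnected : (G : Graph) → (Fin (n G) → Set) → Set
InducesConnected G P =
  ∀ a b → P a → P b → Star (λ x y → E G x y × P x × P y) a b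

SamePair : ∀ {m} → Fin m → Fin m → Fin m → Fin m → Set
SamePair x y u v = (x ≡ u × y ≡ v) ⊎ (x ≡ v × y ≡ u)

-- a tree: a connected graph in which every edge is a bridge (i.e. acyclic)
IsTree : Graph → Set
IsTree T = Connected T ×
  (∀ u v → E T u v →
     ¬ Star (λ x y → E T x y × ¬ SamePair x y u v) u v)

record TreeDecomposition (G : Graph) (w : ℕ) : Set₁ where
  field
    tree      : Graph
    isTree    : IsTree tree
    bag       : Fin (n tree) → Subset (n G)
    covers-V  : ∀ v → ∃ λ t → v ∈ bag t
    covers-E  : ∀ u v → E G u v → ∃ λ t → (u ∈ bag t) × (v ∈ bag t)
    subtree   : ∀ v → InducesConnected tree (λ t → v ∈ bag t)
    width≤    : ∀ t → ∣ bag t ∣ ≤ suc w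

TwAtMost : Graph → ℕ → Set₁
TwAtMost G w = TreeDecomposition G w

record _≅_ (G H : Graph) : Set where
  field
    to      : Fin (n G) → Fin (n H)
    from    : Fin (n H) → Fin (n G)
    to-from : ∀ y → to (from y) ≡ y
    from-to : ∀ x → from (to x) ≡ x
    pres    : ∀ u v → E G u v → E H (to u) (to v)
    refl'   : ∀ u v → E H (to u) (to v) → E G u v

record EdgeContraction (G : Graph) (u v : Fin (n G)) (H : Graph) : Set where
  field
    edge     : E G u v
    f        : Fin (n G) → Fin (n H)
    onto     : ∀ a → ∃ λ x → f x ≡ a
    merges   : f u ≡ f v
    only     : ∀ x y → f x ≡ f y → x ≡ y ⊎ SamePair x y u v
    adj→     : ∀ a b → E H a b →
                 (a ≢ b) × ∃ λ x → ∃ λ y → f x ≡ a × f y ≡ b × E G x y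
    adj←     : ∀ a b → a ≢ b → ∀ x y → f x ≡ a → f y ≡ b → E G x y → E H a b

data ContractsTo : Graph → Graph → Set₁ where
  done : ∀ {G H} → G ≅ H → ContractsTo G H
  step : ∀ {G G' H} (u v : Fin (n G)) → EdgeContraction G u v G' →
           ContractsTo G' H → ContractsTo G H

-- The graph Γ_t (coordinates are 0-based: (x,y) with 0 ≤ x,y ≤ t-1)

ΓRel : ℕ → ℕ → ℕ → ℕ → ℕ → Set
ΓRel t a b c d =
    (a ≡ c × (d ≡ suc b ⊎ b ≡ suc d))
  ⊎ (b ≡ d × (c ≡ suc a ⊎ a ≡ suc c))
  ⊎ (a ≡ suc c × d ≡ suc b)
  -- the corner (t,t) is adjacent to every vertex on the outer face
  ⊎ (a ≡ t ∸ 1 × b ≡ t ∸ 1 × (c ≡ 0 ⊎ c ≡ t ∸ 1 ⊎ d ≡ 0 ⊎ d ≡ t ∸ 1))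

Γ : ℕ → Graph
Γ t = mkGraph (t * t) (λ i j →
  ΓRel t (toℕ (proj₁ (remQuot {t} t i))) (toℕ (proj₂ (remQuot {t} t i)))
         (toℕ (proj₁ (remQuot {t} t j))) (toℕ (proj₂ (remQuot {t} t j))))

data Kind : Set where
  vertexSubset edgeSubset : Kind

data Sense : Set where
  minimization maximization : Sense

record EdgeSubset (G : Graph) : Set where
  field
    sel     : Fin (n G) → Fin (n G) → Bool
    sel-sym : ∀ u v → sel u v ≡ sel v u
    sel-E   : ∀ u v → sel u v ≡ true → E G u v
open EdgeSubset public

edgeCount : (G : Graph) → EdgeSubset G → ℕ
edgeCount G S = sum (map (λ u → sum (map (λ v →
  if (toℕ u <ᵇ toℕ v) ∧ sel S u v then 1 else 0) (allFin (n G)))) (allFin (n G)))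

Solution : Kind → Graph → Set
Solution vertexSubset G = Subset (n G)
Solution edgeSubset   G = EdgeSubset G

size : (κ : Kind) (G : Graph) → Solution κ G → ℕ
size vertexSubset G S = ∣ S ∣
size edgeSubset   G S = edgeCount G S

record Problem : Set₂ where
  field
    kind  : Kind
    sense : Sense
    φ     : (G : Graph) → Solution kind G → Set
open Problem public

InΠ : Problem → Graph → ℕ → Set
InΠ Π G k with sense Π
... | minimization = ∃ λ S → φ Π G S × size (kind Π) G S ≤ k
... | maximization = ∃ λ S → φ Π G S × k ≤ size (kind Π) G S

IsOPT : Problem → Graph → ℕ → Set
IsOPT Π G o with sense Π
... | minimization = InΠ Π G o × (∀ k → InΠ Π G k → o ≤ k)
... | maximization = InΠ Π G o × (∀ k → InΠ Π G k → k ≤ o)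

-- problems are defined on (unlabelled) graphs
IsoInvariant : Problem → Set₁
IsoInvariant Π = ∀ G H → G ≅ H → ∀ k → InΠ Π G k → InΠ Π H k

ContractionClosed : Problem → Set₁
ContractionClosed Π = ∀ G u v H → EdgeContraction G u v H →
  ∀ o → IsOPT Π G o → ∃ λ o' → IsOPT Π H o' × o' ≤ o

-- contraction-closed and OPT_Π(Γ_k) ≥ c k² with c = a/b > 0
ContractionBidimensional : Problem → Set₁
ContractionBidimensional Π = ContractionClosed Π ×
  ∃ λ a → ∃ λ b → 1 ≤ a × 1 ≤ b ×
    (∀ k → 1 ≤ k → ∃ λ o → IsOPT Π (Γ k) o × a * (k * k) ≤ b * o)

-- SQGC: constants λ > 0 and 1 ≤ c = p/q < 2 with tw(G) ≤ λ t^c, i.e.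
-- tw(G)^q ≤ λ^q t^p, for connected G ∈ 𝒢 excluding Γ_t as a contraction

SQGC : (Graph → Set) → Set₁
SQGC 𝒢 = ∃ λ lam → ∃ λ p → ∃ λ q → 1 ≤ lam × 1 ≤ q × q ≤ p × suc p ≤ 2 * q ×
  (∀ G → 𝒢 G → Connected G → ∀ t → 1 ≤ t → ¬ ContractsTo G (Γ t) →
     ∃ λ w → TwAtMost G w × w ^ q ≤ lam ^ q * t ^ p)

-- Every connected graph contracts to the one-vertex graph Γ 1, so bidimensionality at k = 1
-- gives b·OPT ≥ a ≥ 1. Take t = s + 1 with s² ≤ b·OPT < t². OPT does not grow under
-- contractions while b·OPT(Γ t) ≥ a t² ≥ t², so G does not contract to Γ t, and SQGC gives
-- tw^q ≤ λ^q t^p. Squaring and using t² ≤ 4b·OPT yields tw^(2q) ≤ (4bλ)^(2q) OPT^p,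
-- where p < 2q.
module Submission where

open import Defs
open import Data.Nat using (ℕ; zero; suc; _+_; _*_; _^_; _≤_; _<_; z≤n; s≤s; >-nonZero; >-nonZero⁻¹; _<?_)
open import Data.Nat.Properties hiding (_≟_)
open import Data.Nat.Tactic.RingSolver using (solve-∀)
open import Algebra.Properties.CommutativeSemigroup *-commutativeSemigroup using () renaming (interchange to *-interchange)
open import Data.Fin using (Fin; zero; suc; fromℕ<; punchIn; punchOut)
open import Data.Fin.Properties using (_≟_; nonZeroIndex; punchOut-cong; punchOut-injective; punchOut-punchIn; punchInᵢ≢i)
open import Data.Product using (∃; ∃₂; _×_; _,_)
open import Data.Sum using (_⊎_; inj₁; inj₂)
open import Function using (_∘_)
open import Relation.Nullary using (¬_; Dec; yes; no; contradiction)
open import Relation.Binary.PropositionalEquality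
open import Relation.Binary.Construct.Closure.ReflexiveTransitive using (Star; ε; _◅_)

quotient : (G : Graph) {m : ℕ} → (Fin (n G) → Fin m) → Graph
quotient G {m} f = record
  { n     = m
  ; E     = λ a b → a ≢ b × ∃₂ λ x y → f x ≡ a × f y ≡ b × E G x y
  ; E-sym = λ (a≢b , x , y , fx≡a , fy≡b , e) → a≢b ∘ sym , y , x , fy≡b , fx≡a , E-sym G e
  ; E-irr = λ (a≢a , _) → a≢a refl
  }

module _ (G : Graph) {m : ℕ} (f : Fin (n G) → Fin m) where

  quotient-walk : ∀ {x y} → Star (E G) x y → Star (E (quotient G f)) (f x) (f y)
  quotient-walk ε = ε
  quotient-walk {x} {y} (_◅_ {j = z} e w) with f x ≟ f z
  ... | yes fx≡fz = subst (λ a → Star (E (quotient G f)) a (f y)) (sym fx≡fz) (quotient-walk w)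
  ... | no fx≢fz  = (fx≢fz , x , z , refl , refl , e) ◅ quotient-walk w

  module _ (onto : ∀ a → ∃ λ x → f x ≡ a) where

    quotient-connected : Connected G → Connected (quotient G f)
    quotient-connected (1≤n , walk) =
      >-nonZero⁻¹ m {{nonZeroIndex (f (fromℕ< 1≤n))}} , λ a b →
        let (x , fx≡a) = onto a ; (y , fy≡b) = onto b
        in subst₂ (Star _) fx≡a fy≡b (quotient-walk (walk x y))

    quotient-contraction : ∀ {u v} → E G u v → f u ≡ f v →
      (∀ x y → f x ≡ f y → x ≡ y ⊎ SamePair x y u v) →
      EdgeContraction G u v (quotient G f)
    quotient-contraction e merges only = record
      { edge = e ; f = f ; onto = onto ; merges = merges ; only = only
      ; adj→ = λ _ _ ab → ab
      ; adj← = λ _ _ a≢b x y fx≡a fy≡b e → a≢b , x , y , fx≡a , fy≡b , e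
      }

module Merge {k : ℕ} {u v : Fin (suc k)} (u≢v : u ≢ v) where

  redirect : Fin (suc k) → Fin (suc k)
  redirect x with x ≟ v
  ... | yes _ = u
  ... | no _  = x

  v≢redirect : ∀ x → v ≢ redirect x
  v≢redirect x with x ≟ v
  ... | yes _   = u≢v ∘ sym
  ... | no x≢v  = x≢v ∘ sym

  redirect-v : redirect v ≡ u
  redirect-v with v ≟ v
  ... | yes _   = refl
  ... | no v≢v  = contradiction refl v≢v

  redirect-≢ : ∀ {x} → x ≢ v → redirect x ≡ x
  redirect-≢ {x} x≢v with x ≟ v
  ... | yes x≡v = contradiction x≡v x≢v
  ... | no _    = refl

  merge : Fin (suc k) → Fin k
  merge x = punchOut (v≢redirect x)

  merge-onto : ∀ a → ∃ λ x → merge x ≡ a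
  merge-onto a = punchIn v a ,
    trans (punchOut-cong v (redirect-≢ (punchInᵢ≢i v a))) (punchOut-punchIn v)

  merge-uv : merge u ≡ merge v
  merge-uv = punchOut-cong v (trans (redirect-≢ u≢v) (sym redirect-v))

  merge-only : ∀ x y → merge x ≡ merge y → x ≡ y ⊎ SamePair x y u v
  merge-only x y mx≡my = classify (x ≟ v) (y ≟ v)
    where
    rx≡ry : redirect x ≡ redirect y
    rx≡ry = punchOut-injective (v≢redirect x) (v≢redirect y) mx≡my
    classify : Dec (x ≡ v) → Dec (y ≡ v) → x ≡ y ⊎ SamePair x y u v
    classify (yes refl) (yes refl) = inj₁ refl
    classify (yes refl) (no y≢v)   = inj₂ (inj₂ (refl , trans (sym (redirect-≢ y≢v)) (trans (sym rx≡ry) redirect-v)))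
    classify (no x≢v)   (yes refl) = inj₂ (inj₁ (trans (sym (redirect-≢ x≢v)) (trans rx≡ry redirect-v) , refl))
    classify (no x≢v)   (no y≢v)   = inj₁ (trans (sym (redirect-≢ x≢v)) (trans rx≡ry (redirect-≢ y≢v)))

walk⇒edge : ∀ {A : Set} {R : A → A → Set} {a b} → Star R a b → a ≢ b → ∃₂ R
walk⇒edge ε              a≢a = contradiction refl a≢a
walk⇒edge (_◅_ {i} {j} r _) _   = i , j , r

single-vertex-≅ : (G H : Graph) → n G ≡ 1 → n H ≡ 1 → G ≅ H
single-vertex-≅ G H refl refl = record
  { to = λ _ → zero ; from = λ _ → zero
  ; to-from = λ { zero → refl } ; from-to = λ { zero → refl }
  ; pres = λ { zero zero e → contradiction e (E-irr G) }
  ; refl' = λ { zero zero e → contradiction e (E-irr H) }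
  }

connected-contraction : ∀ {k} G → n G ≡ suc (suc k) → Connected G →
  ∃₂ λ u v → ∃ λ H → EdgeContraction G u v H × n H ≡ suc k × Connected H
connected-contraction G refl conn@(_ , walk) with u , v , e ← walk⇒edge (walk zero (suc zero)) (λ ()) =
  u , v , quotient G merge , quotient-contraction G merge merge-onto e merge-uv merge-only ,
  refl , quotient-connected G merge merge-onto conn
  where open Merge (λ u≡v → E-irr G (subst (E G u) (sym u≡v) e))

connected⇒contractsToPoint : ∀ G → Connected G → ContractsTo G (Γ 1)
connected⇒contractsToPoint G = go (n G) G refl
  where
  go : ∀ m G → n G ≡ m → Connected G → ContractsTo G (Γ 1)
  go zero          G refl (() , _)
  go (suc zero)    G refl _ = done (single-vertex-≅ G (Γ 1) refl refl)
  go (suc (suc k)) G size conn =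
    let u , v , H , G/uv→H , sizeH , connH = connected-contraction G size conn
    in step u v G/uv→H (go (suc k) H sizeH connH)

≅-sym : ∀ {G H} → G ≅ H → H ≅ G
≅-sym {G} {H} G≅H = record
  { to = from ; from = to ; to-from = from-to ; from-to = to-from
  ; pres  = λ a b e → refl' (from a) (from b) (subst₂ (E H) (sym (to-from a)) (sym (to-from b)) e)
  ; refl' = λ a b e → subst₂ (E H) (to-from a) (to-from b) (pres (from a) (from b) e)
  }
  where open _≅_ G≅H

IsOPT-resp-≅ : ∀ Π → IsoInvariant Π → ∀ {G H} → G ≅ H → ∀ {o} → IsOPT Π G o → IsOPT Π H o
IsOPT-resp-≅ record { sense = minimization } inv {G} {H} G≅H {o} (feasible , optimal) =
  inv G H G≅H o feasible , λ k H∈Π → optimal k (inv H G (≅-sym G≅H) k H∈Π)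
IsOPT-resp-≅ record { sense = maximization } inv {G} {H} G≅H {o} (feasible , optimal) =
  inv G H G≅H o feasible , λ k H∈Π → optimal k (inv H G (≅-sym G≅H) k H∈Π)

IsOPT-unique : ∀ Π {G o o'} → IsOPT Π G o → IsOPT Π G o' → o ≡ o'
IsOPT-unique record { sense = minimization } (o∈Π , o-min) (o'∈Π , o'-min) = ≤-antisym (o-min _ o'∈Π) (o'-min _ o∈Π)
IsOPT-unique record { sense = maximization } (o∈Π , o-max) (o'∈Π , o'-max) = ≤-antisym (o'-max _ o∈Π) (o-max _ o'∈Π)

ContractsTo⇒OPT-≤ : ∀ Π → IsoInvariant Π → ContractionClosed Π → ∀ {G H} → ContractsTo G H →
  ∀ {o} → IsOPT Π G o → ∃ λ o' → IsOPT Π H o' × o' ≤ o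
ContractsTo⇒OPT-≤ Π inv closed (done G≅H) {o} opt = o , IsOPT-resp-≅ Π inv G≅H opt , ≤-refl
ContractsTo⇒OPT-≤ Π inv closed {G} (step {G' = G'} u v G/uv c) {o} opt =
  let o₁ , opt₁ , o₁≤o = closed G u v G' G/uv o opt
      o₂ , opt₂ , o₂≤o₁ = ContractsTo⇒OPT-≤ Π inv closed c opt₁
  in o₂ , opt₂ , ≤-trans o₂≤o₁ o₁≤o

module Bidimensional (Π : Problem) (inv : IsoInvariant Π) (closed : ContractionClosed Π)
  {a b : ℕ} (1≤a : 1 ≤ a) (grid-bound : ∀ k → 1 ≤ k → ∃ λ o → IsOPT Π (Γ k) o × a * (k * k) ≤ b * o) where

  contractsToΓ⇒OPT-≥ : ∀ {G t o} → 1 ≤ t → ContractsTo G (Γ t) → IsOPT Π G o → a * (t * t) ≤ b * o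
  contractsToΓ⇒OPT-≥ {t = t} 1≤t c opt =
    let o' , opt' , o'≤o = ContractsTo⇒OPT-≤ Π inv closed c opt
        _ , optΓ , bound = grid-bound t 1≤t
    in ≤-trans bound (*-monoʳ-≤ b (≤-trans (≤-reflexive (IsOPT-unique Π optΓ opt')) o'≤o))

  1≤b*OPT : ∀ {G o} → Connected G → IsOPT Π G o → 1 ≤ b * o
  1≤b*OPT {G} conn opt = ≤-trans 1≤a (≤-trans (≤-reflexive (sym (*-identityʳ a)))
    (contractsToΓ⇒OPT-≥ ≤-refl (connected⇒contractsToPoint G conn) opt))

  Γ-excluded : ∀ {G t o} → IsOPT Π G o → b * o < suc t * suc t → ¬ ContractsTo G (Γ (suc t))
  Γ-excluded {t = t} opt bo<t² c = <⇒≱ bo<t²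
    (≤-trans (m≤n*m (suc t * suc t) a {{>-nonZero 1≤a}}) (contractsToΓ⇒OPT-≥ (s≤s z≤n) c opt))

sqrt-bracket : ∀ N → ∃ λ s → s * s ≤ N × N < suc s * suc s
sqrt-bracket zero = 0 , z≤n , s≤s z≤n
sqrt-bracket (suc N) with sqrt-bracket N
... | s , s²≤N , N<[1+s]² with suc N <? suc s * suc s
...   | yes N+1<[1+s]² = s , m≤n⇒m≤1+n s²≤N , N+1<[1+s]²
...   | no  N+1≮[1+s]² = suc s , ≮⇒≥ N+1≮[1+s]² , ≤-<-trans N<[1+s]² square-mono
  where
  square-mono : suc s * suc s < suc (suc s) * suc (suc s)
  square-mono = *-mono-< (n<1+n (suc s)) (n<1+n (suc s))

suc-square≤4* : ∀ s {N} → 1 ≤ N → s * s ≤ N → suc s * suc s ≤ 4 * N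
suc-square≤4* zero        1≤N _    = ≤-trans 1≤N (m≤n*m _ 4)
suc-square≤4* (suc r) {N} _   s²≤N = begin
  suc (suc r) * suc (suc r)                       ≤⟨ m≤m+n _ (3 * r * r + 4 * r) ⟩
  suc (suc r) * suc (suc r) + (3 * r * r + 4 * r) ≡⟨ expand r ⟩
  4 * (suc r * suc r)                             ≤⟨ *-monoʳ-≤ 4 s²≤N ⟩
  4 * N                                           ∎
  where
  open ≤-Reasoning
  expand : ∀ r → suc (suc r) * suc (suc r) + (3 * r * r + 4 * r) ≡ 4 * (suc r * suc r)
  expand = solve-∀

^-distribʳ-* : ∀ m n k → (m * n) ^ k ≡ m ^ k * n ^ k
^-distribʳ-* m n zero    = refl
^-distribʳ-* m n (suc k) = begin
  m * n * (m * n) ^ k       ≡⟨ cong (m * n *_) (^-distribʳ-* m n k) ⟩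
  m * n * (m ^ k * n ^ k)   ≡⟨ *-interchange m n (m ^ k) (n ^ k) ⟩
  m * m ^ k * (n * n ^ k)   ∎
  where open ≡-Reasoning

^-double : ∀ m k → m ^ (2 * k) ≡ m ^ k * m ^ k
^-double m k = trans (cong (m ^_) (cong (k +_) (+-identityʳ k))) (^-distribˡ-+-* m k k)

tw-power-bound : ∀ {w lam c o} t p q → 1 ≤ c → p ≤ 2 * q → w ^ q ≤ lam ^ q * t ^ p → t * t ≤ c * o →
  w ^ (2 * q) ≤ (lam * c) ^ (2 * q) * o ^ p
tw-power-bound {w} {lam} {c} {o} t p q 1≤c p≤2q w^q≤ t²≤co = begin
  w ^ (2 * q)                           ≡⟨ ^-double w q ⟩
  w ^ q * w ^ q                         ≤⟨ *-mono-≤ w^q≤ w^q≤ ⟩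
  lam ^ q * t ^ p * (lam ^ q * t ^ p)   ≡⟨ *-interchange (lam ^ q) (t ^ p) (lam ^ q) (t ^ p) ⟩
  lam ^ q * lam ^ q * (t ^ p * t ^ p)   ≡⟨ cong₂ _*_ (sym (^-double lam q)) (sym (^-distribʳ-* t t p)) ⟩
  lam ^ (2 * q) * (t * t) ^ p           ≤⟨ *-monoʳ-≤ (lam ^ (2 * q)) (^-monoˡ-≤ p t²≤co) ⟩
  lam ^ (2 * q) * (c * o) ^ p           ≡⟨ cong (lam ^ (2 * q) *_) (^-distribʳ-* c o p) ⟩
  lam ^ (2 * q) * (c ^ p * o ^ p)       ≤⟨ *-monoʳ-≤ (lam ^ (2 * q)) (*-monoˡ-≤ (o ^ p) c^p≤c^2q) ⟩
  lam ^ (2 * q) * (c ^ (2 * q) * o ^ p) ≡⟨ sym (*-assoc (lam ^ (2 * q)) _ _) ⟩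
  lam ^ (2 * q) * c ^ (2 * q) * o ^ p   ≡⟨ cong (_* o ^ p) (sym (^-distribʳ-* lam c (2 * q))) ⟩
  (lam * c) ^ (2 * q) * o ^ p           ∎
  where
  open ≤-Reasoning
  c^p≤c^2q : c ^ p ≤ c ^ (2 * q)
  c^p≤c^2q = ^-monoʳ-≤ c {{>-nonZero 1≤c}} p≤2q

lemma2 : (𝒢 : Graph → Set) → SQGC 𝒢 → (Π : Problem) → IsoInvariant Π → ContractionBidimensional Π →
    ∃ λ α → ∃ λ p → ∃ λ q → 1 ≤ α × 1 ≤ p × suc p ≤ q ×
      (∀ G → 𝒢 G → Connected G → ∀ o → IsOPT Π G o →
        ∃ λ w → TwAtMost G w × w ^ q ≤ α ^ q * o ^ p)
lemma2 𝒢 (lam , p , q , 1≤lam , 1≤q , q≤p , p<2q , sqgc) Π inv (closed , a , b , 1≤a , 1≤b , grid-bound) =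
  lam * c , p , 2 * q , *-mono-≤ 1≤lam 1≤c , ≤-trans 1≤q q≤p , p<2q , tw-bound
  where
  open Bidimensional Π inv closed {a} {b} 1≤a grid-bound
  c : ℕ
  c = 4 * b
  1≤c : 1 ≤ c
  1≤c = ≤-trans 1≤b (m≤n*m b 4)
  tw-bound : ∀ G → 𝒢 G → Connected G → ∀ o → IsOPT Π G o →
    ∃ λ w → TwAtMost G w × w ^ (2 * q) ≤ (lam * c) ^ (2 * q) * o ^ p
  tw-bound G G∈𝒢 conn o opt =
    let s , s²≤bo , bo<t² = sqrt-bracket (b * o)
        w , decomposition , w^q≤ = sqgc G G∈𝒢 conn (suc s) (s≤s z≤n) (Γ-excluded opt bo<t²)
        t²≤co = subst (suc s * suc s ≤_) (sym (*-assoc 4 b o)) (suc-square≤4* s (1≤b*OPT conn opt) s²≤bo)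
    in w , decomposition , tw-power-bound (suc s) p q 1≤c (<⇒≤ p<2q) w^q≤ t²≤co
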